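{- For every $n\ge0$, the set $\{{\mathfrak S}_\alpha : \alpha \text{ a composition of } n\}$ is a basis of $\mathsf{NSym}_n$.
   Context: Work over $\mathbb{Q}$. A composition of $n$ is a sequence of positive integers summing to $n$. $\mathsf{NSym}$ is the free associative $\mathbb{Q}$-algebra on $H_1,H_2,\dots$, graded by $\deg H_i=i$, with degree-$n$ component $\mathsf{NSym}_n$; $H_{(a_1,\dots,a_m)}=H_{a_1}\cdots H_{a_m}$, $H_0=1$, $H_{ -r}=0$ for $r>0$. $\mathsf{QSym}$ is the algebra of quasi-symmetric functions with monomial basis $M_\alpha=\sum_{i_1<\dots<i_m}x_{i_1}^{\alpha_1}\cdots x_{i_m}^{\alpha_m}$, paired with $\mathsf{NSym}$ by $\langle H_\alpha,M_\beta\rangle=\delta_{\alpha,\beta}$; for $F\in\mathsf{QSym}$, $F^\perp$ on $\mathsf{NSym}$ is defined by $\langle F^\perp H,G\rangle=\langle H,FG\rangle$ for all $G$. With $D(\alpha)=\{\alpha_1,\alpha_1+\alpha_2,\dots,\alpha_1+\dots+\alpha_{m-1}\}$, refinement is $\alpha\le\beta$ iff $D(\beta)\subseteq D(\alpha)$; $F_\alpha=\sum_{\beta\le\alpha}M_\beta$ and $F_{1^i}=F_{(1,\dots,1)}$ ($i$ ones, $F_{1^0}=1$). $\mathbb{B}_m=\sum_{i\ge0}(-1)^iH_{m+i}F_{1^i}^\perp$, and for $\alpha\in\mathbb{Z}^m$, ${\mathfrak S}_\alpha=\mathbb{B}_{\alpha_1}\cdots\mathbb{B}_{\alpha_m}(1)$.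 -}

module Defs where

open import Data.Nat as ℕ using (ℕ; zero; suc; _≤_)
open import Data.Integer as ℤ using (ℤ; +_; -[1+_])
open import Data.Rational as ℚ using (ℚ; 0ℚ; 1ℚ)
open import Data.List using (List; []; _∷_; [_]; _++_; map; concatMap; foldr; filterᵇ; upTo; replicate)
open import Data.Nat.ListAction using (sum)
open import Data.List.Relation.Unary.All using (All)
open import Data.List.Properties using (≡-dec)
open import Data.Product using (_×_; _,_; proj₁; proj₂)
open import Data.Bool using (Bool; true; false; if_then_else_; _∧_; _∨_)
open import Relation.Nullary.Decidable using (⌊_⌋)
open import Relation.Binary.PropositionalEquality using (_≡_)
open import Relation.Nullary using (¬_)

Word : Set
Word = List ℕ

IsComposition : ℕ → Word → Set
IsComposition n α = All (λ k → 1 ≤ k) α × sum α ≡ n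

incHead : Word → Word
incHead [] = []
incHead (x ∷ w) = suc x ∷ w

compositions : ℕ → List Word
compositions zero = [ [] ]
compositions (suc zero) = [ 1 ∷ [] ]
compositions (suc (suc n)) =
  concatMap (λ c → (1 ∷ c) ∷ incHead c ∷ []) (compositions (suc n))

compositionsUpTo : ℕ → List Word
compositionsUpTo d = concatMap compositions (upTo (suc d))

wordEq : Word → Word → Bool
wordEq u v = ⌊ ≡-dec ℕ._≟_ u v ⌋

Lin : Set
Lin = List (ℚ × Word)

coeff : Lin → Word → ℚ
coeff v w = foldr (λ p acc → if wordEq (proj₂ p) w then proj₁ p ℚ.+ acc else acc) 0ℚ v

scaleL : ℚ → Lin → Lin
scaleL c = map (λ p → (c ℚ.* proj₁ p , proj₂ p))

mulWith : (Word → Word → Lin) → Lin → Lin → Lin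
mulWith f u v =
  concatMap (λ p → concatMap (λ r → scaleL (proj₁ p ℚ.* proj₁ r) (f (proj₂ p) (proj₂ r))) v) u

sumℚ : List ℚ → ℚ
sumℚ = foldr ℚ._+_ 0ℚ

-- NSym, in the basis H_α (α a composition): the word α stands for H_α

NSym : Set
NSym = Lin

oneN : NSym
oneN = [ (1ℚ , []) ]

Hw : Word → NSym
Hw α = [ (1ℚ , α) ]

Hz : ℤ → NSym
Hz (+ zero) = oneN
Hz (+ suc k) = [ (1ℚ , suc k ∷ []) ]
Hz -[1+ _ ] = []

_·N_ : NSym → NSym → NSym
_·N_ = mulWith (λ a b → [ (1ℚ , a ++ b) ])

degBound : NSym → ℕ
degBound = foldr (λ p m → sum (proj₂ p) ℕ.⊔ m) 0

-- QSym, in the monomial basis M_α: the word α stands for M_α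

QSym : Set
QSym = Lin

M : Word → QSym
M α = [ (1ℚ , α) ]

qsh : Word → Word → List Word
qsh [] b = [ b ]
qsh (x ∷ a) [] = [ x ∷ a ]
qsh (x ∷ a) (y ∷ b) =
  map (x ∷_) (qsh a (y ∷ b)) ++ map (y ∷_) (qsh (x ∷ a) b) ++ map ((x ℕ.+ y) ∷_) (qsh a b)

_·Q_ : QSym → QSym → QSym
_·Q_ = mulWith (λ a b → map (λ c → (1ℚ , c)) (qsh a b))

D : Word → List ℕ
D [] = []
D (a ∷ []) = []
D (a ∷ b ∷ r) = a ∷ map (a ℕ.+_) (D (b ∷ r))

memᵇ : ℕ → List ℕ → Bool
memᵇ x = foldr (λ y b → ⌊ x ℕ.≟ y ⌋ ∨ b) false

subsetᵇ : List ℕ → List ℕ → Bool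
subsetᵇ xs ys = foldr (λ x b → memᵇ x ys ∧ b) true xs

refinesᵇ : Word → Word → Bool
refinesᵇ α β = subsetᵇ (D β) (D α)

Fq : Word → QSym
Fq α = map (λ β → (1ℚ , β)) (filterᵇ (λ β → refinesᵇ β α) (compositions (sum α)))

-- duality pairing ⟨H_α , M_β⟩ = δ_{α,β}, extended bilinearly
pair : NSym → QSym → ℚ
pair h g = sumℚ (map (λ p → proj₁ p ℚ.* coeff g (proj₂ p)) h)

-- F^⊥ h = Σ_β ⟨F^⊥ h , M_β⟩ H_β = Σ_β ⟨h , F M_β⟩ H_β.
-- (⟨h , F M_β⟩ = 0 when |β| exceeds the degree of h, so β ranges over
-- compositions of size ≤ degBound h.)
perp : QSym → NSym → NSym
perp f h = map (λ β → (pair h (f ·Q M β) , β)) (compositionsUpTo (degBound h))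

signℚ : ℕ → ℚ
signℚ zero = 1ℚ
signℚ (suc i) = ℚ.- signℚ i

-- 𝔹_m h = Σ_{i ≥ 0} (-1)^i H_{m+i} F_{1^i}^⊥ h ; terms with i > deg h vanish
𝔹 : ℤ → NSym → NSym
𝔹 m h = concatMap
  (λ i → scaleL (signℚ i) (Hz (m ℤ.+ + i) ·N perp (Fq (replicate i 1)) h))
  (upTo (suc (degBound h)))

𝔖 : List ℤ → NSym
𝔖 α = foldr 𝔹 oneN α

𝔖c : Word → NSym
𝔖c α = 𝔖 (map +_ α)

InNSym : ℕ → NSym → Set
InNSym n v = (w : Word) → ¬ IsComposition n w → coeff v w ≡ 0ℚ

combo : (Word → ℚ) → (Word → NSym) → List Word → NSym
combo c f idx = concatMap (λ α → scaleL (c α) (f α)) idx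

-- Write α = (m, α′) with m ≥ 1.  The coefficient of H_(x,w) in
-- 𝔹_m h = Σᵢ (−1)ⁱ H_{m+i} F_{1ⁱ}^⊥ h comes from the single term with m + i = x.
-- Hence it vanishes for x < m, while for x = m only i = 0 survives and F_{1⁰}^⊥ is
-- the identity.  Since F_{1ⁱ}^⊥ lowers degrees by i, 𝔹_m maps NSym_n into
-- NSym_{m+n}.  By induction on α, 𝔖_α lies in NSym_{|α|} and equals H_α plus
-- terms H_β with β lexicographically larger.  A family indexed by the compositions
-- of n that is unitriangular for a total order is a basis: the coefficients of a
-- vanishing combination vanish by induction from the bottom, and each H_α is
-- reached by induction from the top.

module Submission where

open import Defs
open import Data.Bool using (if_then_else_)
open import Data.Empty using (⊥-elim)
open import Data.Integer as ℤ using ()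
open import Data.List using (List; []; _∷_; _++_; map; concatMap; foldr; filter; length; upTo; replicate)
open import Data.List.Membership.Propositional using (_∈_)
open import Data.List.Membership.Propositional.Properties using (∈-filter⁺; ∈-upTo⁺)
open import Data.List.Properties using (filter-notAll; ≡-dec; ∷-injectiveˡ; ∷-injectiveʳ)
open import Data.List.Relation.Binary.Lex.Strict as Lex using (Lex-<; base; halt; this; next)
open import Data.List.Relation.Binary.Pointwise using (Pointwise; Pointwise-≡⇒≡; ≡⇒Pointwise-≡)
open import Data.List.Relation.Unary.All as All using (All; []; _∷_)
open import Data.List.Relation.Unary.All.Properties using (concat⁺; map⁺; ++⁺; filter⁺)
open import Data.List.Relation.Unary.Any as Any using (here; there)
open import Data.List.Relation.Unary.Unique.Propositional using (Unique; []; _∷_)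
open import Data.List.Relation.Unary.Unique.Propositional.Properties using (upTo⁺)
open import Data.Nat as ℕ using (ℕ; zero; suc)
open import Data.Nat.Induction using (<-wellFounded)
open import Data.Nat.ListAction using (sum)
open import Data.Nat.Properties as ℕP using ()
open import Data.Nat.Tactic.RingSolver using (solve-∀)
open import Data.Product using (_×_; _,_; proj₁; proj₂; ∃-syntax)
open import Data.Rational as ℚ using (ℚ; 0ℚ; 1ℚ; _+_; _*_; _-_; -_)
open import Data.Rational.Properties as ℚP using ()
open import Data.Rational.Solver using (module +-*-Solver)
open import Function using (_∘_)
open import Function.Definitions using (Injective)
open import Induction.WellFounded as WF using ()
open import Level using (0ℓ)
open import Relation.Binary.Construct.On as On using ()
open import Relation.Binary.Core using (Rel)
open import Relation.Binary.Definitions using (DecidableEquality; Tri; tri<; tri≈; tri>)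
open import Relation.Binary.PropositionalEquality
open import Relation.Binary.PropositionalEquality.Properties using (isEquivalence)
open import Relation.Binary.Structures using (IsStrictTotalOrder)
open import Relation.Nullary using (¬_; Dec; yes; no; ⌊_⌋)
open import Relation.Nullary.Decidable using (T?; _×-dec_)
open import Relation.Unary using (Pred; Decidable; _⊆_)

open +-*-Solver

∑ : {A : Set} → List A → (A → ℚ) → ℚ
∑ xs f = foldr (λ x s → f x + s) 0ℚ xs

syntax ∑ xs (λ x → e) = ∑[ x ∈ xs ] e

private
  variable
    A B : Set

∑-++ : (xs ys : List A) (f : A → ℚ) → ∑ (xs ++ ys) f ≡ ∑ xs f + ∑ ys f
∑-++ []       ys f = sym (ℚP.+-identityˡ _)
∑-++ (x ∷ xs) ys f = trans (cong (f x +_) (∑-++ xs ys f)) (sym (ℚP.+-assoc (f x) _ _))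

∑-cong-All : {P : A → Set} {xs : List A} {f g : A → ℚ} →
             (∀ {x} → P x → f x ≡ g x) → All P xs → ∑ xs f ≡ ∑ xs g
∑-cong-All f≡g []         = refl
∑-cong-All f≡g (px ∷ pxs) = cong₂ _+_ (f≡g px) (∑-cong-All f≡g pxs)

∑-cong : (xs : List A) {f g : A → ℚ} → (∀ x → f x ≡ g x) → ∑ xs f ≡ ∑ xs g
∑-cong []       f≡g = refl
∑-cong (x ∷ xs) f≡g = cong₂ _+_ (f≡g x) (∑-cong xs f≡g)

∑-zero : (xs : List A) {f : A → ℚ} → (∀ x → f x ≡ 0ℚ) → ∑ xs f ≡ 0ℚ
∑-zero xs f≡0 = trans (∑-cong xs f≡0) (∑-0 xs)
  where
  ∑-0 : (xs : List A) → ∑[ x ∈ xs ] 0ℚ ≡ 0ℚ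
  ∑-0 []       = refl
  ∑-0 (x ∷ xs) = cong (0ℚ +_) (∑-0 xs)

∑-+ : (xs : List A) (f g : A → ℚ) → ∑[ x ∈ xs ] (f x + g x) ≡ ∑ xs f + ∑ xs g
∑-+ []       f g = refl
∑-+ (x ∷ xs) f g = trans (cong (f x + g x +_) (∑-+ xs f g))
  (solve 4 (λ a b c d → (a :+ b) :+ (c :+ d) := (a :+ c) :+ (b :+ d)) refl (f x) (g x) (∑ xs f) (∑ xs g))

∑-*ˡ : (c : ℚ) (xs : List A) (f : A → ℚ) → ∑[ x ∈ xs ] (c * f x) ≡ c * ∑ xs f
∑-*ˡ c []       f = sym (ℚP.*-zeroʳ c)
∑-*ˡ c (x ∷ xs) f = trans (cong (c * f x +_) (∑-*ˡ c xs f)) (sym (ℚP.*-distribˡ-+ c (f x) _))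

∑-swap : (xs : List A) (ys : List B) (f : A → B → ℚ) →
         ∑[ x ∈ xs ] ∑[ y ∈ ys ] f x y ≡ ∑[ y ∈ ys ] ∑[ x ∈ xs ] f x y
∑-swap []       ys f = sym (∑-zero ys (λ _ → refl))
∑-swap (x ∷ xs) ys f = trans (cong (∑ ys (f x) +_) (∑-swap xs ys f)) (sym (∑-+ ys (f x) _))

∑-map : (g : A → B) (xs : List A) (f : B → ℚ) → ∑ (map g xs) f ≡ ∑ xs (f ∘ g)
∑-map g []       f = refl
∑-map g (x ∷ xs) f = cong (f (g x) +_) (∑-map g xs f)

∑-concatMap : (g : A → List B) (xs : List A) (f : B → ℚ) →
              ∑ (concatMap g xs) f ≡ ∑[ x ∈ xs ] ∑ (g x) f
∑-concatMap g []       f = refl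
∑-concatMap g (x ∷ xs) f = trans (∑-++ (g x) (concatMap g xs) f) (cong (∑ (g x) f +_) (∑-concatMap g xs f))

module KroneckerDelta {A : Set} (_≟_ : DecidableEquality A) where

  δ : A → A → ℚ
  δ u w = if ⌊ u ≟ w ⌋ then 1ℚ else 0ℚ

  δ-refl : ∀ w → δ w w ≡ 1ℚ
  δ-refl w with w ≟ w
  ... | yes _   = refl
  ... | no w≢w = ⊥-elim (w≢w refl)

  δ-≢ : ∀ {u w} → ¬ u ≡ w → δ u w ≡ 0ℚ
  δ-≢ {u} {w} u≢w with u ≟ w
  ... | yes u≡w = ⊥-elim (u≢w u≡w)
  ... | no _    = refl

  δ-sym : ∀ u w → δ u w ≡ δ w u
  δ-sym u w with u ≟ w
  ... | yes refl = sym (δ-refl u)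
  ... | no u≢w   = sym (δ-≢ (u≢w ∘ sym))

  δ-injective : {f : A → A} → Injective _≡_ _≡_ f → ∀ u w → δ (f u) (f w) ≡ δ u w
  δ-injective f-inj u w with u ≟ w
  ... | yes refl = δ-refl _
  ... | no u≢w   = δ-≢ (u≢w ∘ f-inj)

  ∑-δ : (xs : List A) (a : A → ℚ) (w : A) → ∑[ u ∈ xs ] (a u * δ u w) ≡ a w * ∑[ u ∈ xs ] δ u w
  ∑-δ xs a w = trans (∑-cong xs sift) (∑-*ˡ (a w) xs (λ u → δ u w))
    where
    sift : ∀ u → a u * δ u w ≡ a w * δ u w
    sift u with u ≟ w
    ... | yes refl = refl
    ... | no _     = trans (ℚP.*-zeroʳ (a u)) (sym (ℚP.*-zeroʳ (a w)))

  multiplicity : A → List A → ℚ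
  multiplicity w xs = ∑[ u ∈ xs ] δ u w

  multiplicity-∉ : ∀ {w} {xs : List A} → All (λ u → ¬ u ≡ w) xs → multiplicity w xs ≡ 0ℚ
  multiplicity-∉ {w} {xs} u≢w = trans (∑-cong-All δ-≢ u≢w) (∑-zero xs λ _ → refl)

  multiplicity-unique : ∀ {w} {xs : List A} → Unique xs → w ∈ xs → multiplicity w xs ≡ 1ℚ
  multiplicity-unique (x≢xs ∷ _) (here refl) =
    cong₂ _+_ (δ-refl _) (multiplicity-∉ (All.map (λ x≢u → x≢u ∘ sym) x≢xs))
  multiplicity-unique (x≢xs ∷ u) (there w∈xs) =
    trans (cong₂ _+_ (δ-≢ (All.lookup x≢xs w∈xs)) (multiplicity-unique u w∈xs)) (ℚP.+-identityˡ 1ℚ)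

  multiplicity-map-injective : {f : A → A} → Injective _≡_ _≡_ f → ∀ w xs →
                               multiplicity (f w) (map f xs) ≡ multiplicity w xs
  multiplicity-map-injective {f} f-inj w xs =
    trans (∑-map f xs (λ u → δ u (f w))) (∑-cong xs λ u → δ-injective f-inj u w)

  multiplicity-map-∉ : {f : A → A} {w : A} → (∀ u → ¬ f u ≡ w) → ∀ xs → multiplicity w (map f xs) ≡ 0ℚ
  multiplicity-map-∉ {f} {w} f≢w xs =
    trans (∑-map f xs (λ u → δ u w)) (∑-zero xs λ u → δ-≢ (f≢w u))

  Enumerates : (A → Set) → List A → Set
  Enumerates P xs = ∀ w → (P w → multiplicity w xs ≡ 1ℚ) × (¬ P w → multiplicity w xs ≡ 0ℚ)

  enumerates-singleton : ∀ {P : A → Set} {u} → (∀ {w} → P w → u ≡ w) → P u → Enumerates P (u ∷ [])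
  enumerates-singleton {P} {u} P⇒≡u pu w =
    (λ pw → trans (cong (λ v → δ u v + 0ℚ) (sym (P⇒≡u pw))) (cong (_+ 0ℚ) (δ-refl u))) ,
    (λ ¬pw → cong (_+ 0ℚ) (δ-≢ λ { refl → ¬pw pu }))

  multiplicity≢0⇒∈ : ∀ {w} (xs : List A) → ¬ multiplicity w xs ≡ 0ℚ → w ∈ xs
  multiplicity≢0⇒∈         []       m≢0 = ⊥-elim (m≢0 refl)
  multiplicity≢0⇒∈ {w} (x ∷ xs) m≢0 with x ≟ w
  ... | yes refl = here refl
  ... | no _     = there (multiplicity≢0⇒∈ xs (m≢0 ∘ trans (ℚP.+-identityˡ _)))

-- Unitriangular families

filter-filter-⊆ : {P Q : Pred A 0ℓ} (P? : Decidable P) (Q? : Decidable Q) → P ⊆ Q →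
                 (xs : List A) → filter P? (filter Q? xs) ≡ filter P? xs
filter-filter-⊆ P? Q? P⊆Q []       = refl
filter-filter-⊆ P? Q? P⊆Q (x ∷ xs) with Q? x
... | yes _ with P? x
...   | yes _ = cong (x ∷_) (filter-filter-⊆ P? Q? P⊆Q xs)
...   | no _  = filter-filter-⊆ P? Q? P⊆Q xs
filter-filter-⊆ P? Q? P⊆Q (x ∷ xs) | no ¬q with P? x
...   | yes p = ⊥-elim (¬q (P⊆Q p))
...   | no _  = filter-filter-⊆ P? Q? P⊆Q xs

length-filter-⊂ : {P Q : Pred A 0ℓ} (P? : Decidable P) (Q? : Decidable Q) → P ⊆ Q →
                  ∀ {y xs} → y ∈ xs → Q y → ¬ P y → length (filter P? xs) ℕ.< length (filter Q? xs)
length-filter-⊂ P? Q? P⊆Q {y} {xs} y∈xs qy ¬py =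
  subst (ℕ._< length (filter Q? xs)) (cong length (filter-filter-⊆ P? Q? P⊆Q xs))
    (filter-notAll P? (filter Q? xs) (Any.map (λ { refl → ¬py }) (∈-filter⁺ Q? y∈xs qy)))

module UnitriangularBasis
  {A : Set} (_≟_ : DecidableEquality A)
  {_<_ : Rel A 0ℓ} (<-isStrictTotalOrder : IsStrictTotalOrder _≡_ _<_)
  {P : Pred A 0ℓ} (P? : Decidable P)
  (L : List A) (L⊆P : All P L)
  (multiplicity-L : ∀ {w} → P w → KroneckerDelta.multiplicity _≟_ w L ≡ 1ℚ)
  (v : A → A → ℚ)
  (v-supported      : ∀ {α w} → P α → ¬ P w → v α w ≡ 0ℚ)
  (v-diagonal       : ∀ {α} → P α → v α α ≡ 1ℚ)
  (v-vanishes-below : ∀ {α w} → P α → w < α → v α w ≡ 0ℚ)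
  where

  open KroneckerDelta _≟_
  open IsStrictTotalOrder <-isStrictTotalOrder using (compare; irrefl; _<?_)
    renaming (trans to <-trans)

  combination : (A → ℚ) → A → ℚ
  combination c w = ∑[ β ∈ L ] (c β * v β w)

  -- Strictly monotone along _<_ on P, so they drive the two inductions.
  below above : A → ℕ
  below α = length (filter (_<? α) L)
  above α = length (filter (α <?_) L)

  ∈-L : ∀ {β} → P β → β ∈ L
  ∈-L pβ = multiplicity≢0⇒∈ L (λ m≡0 → 1≢0 (trans (sym (multiplicity-L pβ)) m≡0))
    where
    1≢0 : ¬ 1ℚ ≡ 0ℚ
    1≢0 ()

  below-mono : ∀ {α β} → P β → β < α → below β ℕ.< below α
  below-mono pβ β<α = length-filter-⊂ (_<? _) (_<? _) (λ γ<β → <-trans γ<β β<α) (∈-L pβ) β<α (irrefl refl)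

  above-mono : ∀ {α β} → P β → α < β → above β ℕ.< above α
  above-mono pβ α<β = length-filter-⊂ (_ <?_) (_ <?_) (<-trans α<β) (∈-L pβ) α<β (irrefl refl)

  private
    measureRec : (μ : A → ℕ) {Goal : A → Set} →
                (∀ α → (∀ {β} → μ β ℕ.< μ α → Goal β) → Goal α) → ∀ α → Goal α
    measureRec μ {Goal} step = WF.All.wfRec (On.wellFounded μ <-wellFounded) 0ℓ Goal step

  linearlyIndependent : (c : A → ℚ) → (∀ w → combination c w ≡ 0ℚ) → ∀ {α} → P α → c α ≡ 0ℚ
  linearlyIndependent c combination≡0 {α} = measureRec below step α
    where
    step : ∀ α → (∀ {β} → below β ℕ.< below α → P β → c β ≡ 0ℚ) → P α → c α ≡ 0ℚ
    step α rec pα = begin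
      c α                            ≡⟨ sym (ℚP.*-identityʳ (c α)) ⟩
      c α * 1ℚ                       ≡⟨ cong (c α *_) (multiplicity-L pα) ⟨
      c α * multiplicity α L         ≡⟨ ∑-*ˡ (c α) L (λ β → δ β α) ⟨
      ∑[ β ∈ L ] (c α * δ β α)       ≡⟨ ∑-cong-All term L⊆P ⟩
      ∑[ β ∈ L ] (c β * v β α)       ≡⟨ combination≡0 α ⟩
      0ℚ                             ∎
      where
      open ≡-Reasoning
      term : ∀ {β} → P β → c α * δ β α ≡ c β * v β α
      term {β} pβ with compare β α
      ... | tri≈ _ refl _ = cong (c β *_) (trans (δ-refl β) (sym (v-diagonal pβ)))
      ... | tri< β<α β≢α _ = begin
        c α * δ β α  ≡⟨ cong (c α *_) (δ-≢ β≢α) ⟩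
        c α * 0ℚ     ≡⟨ ℚP.*-zeroʳ (c α) ⟩
        0ℚ           ≡⟨ ℚP.*-zeroˡ (v β α) ⟨
        0ℚ * v β α   ≡⟨ cong (_* v β α) (rec (below-mono pβ β<α) pβ) ⟨
        c β * v β α  ∎
      ... | tri> _ β≢α α<β = begin
        c α * δ β α  ≡⟨ cong (c α *_) (δ-≢ β≢α) ⟩
        c α * 0ℚ     ≡⟨ ℚP.*-zeroʳ (c α) ⟩
        0ℚ           ≡⟨ ℚP.*-zeroʳ (c β) ⟨
        c β * 0ℚ     ≡⟨ cong (c β *_) (v-vanishes-below pβ α<β) ⟨
        c β * v β α  ∎

  Spanned : (A → ℚ) → Set
  Spanned f = ∃[ c ] (∀ w → combination c w ≡ f w)

  spanned-ext : ∀ {f g} → Spanned f → (∀ w → f w ≡ g w) → Spanned g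
  spanned-ext (c , c↦f) f≡g = c , λ w → trans (c↦f w) (f≡g w)

  spanned-0 : Spanned (λ _ → 0ℚ)
  spanned-0 = (λ _ → 0ℚ) , λ w → ∑-zero L (λ β → ℚP.*-zeroˡ (v β w))

  spanned-+ : ∀ {f g} → Spanned f → Spanned g → Spanned (λ w → f w + g w)
  spanned-+ (c , c↦f) (d , d↦g) = (λ β → c β + d β) , λ w →
    trans (∑-cong L (λ β → ℚP.*-distribʳ-+ (v β w) (c β) (d β)))
      (trans (∑-+ L (λ β → c β * v β w) (λ β → d β * v β w)) (cong₂ _+_ (c↦f w) (d↦g w)))

  spanned-* : ∀ {f} a → Spanned f → Spanned (λ w → a * f w)
  spanned-* a (c , c↦f) = (λ β → a * c β) , λ w →
    trans (∑-cong L (λ β → ℚP.*-assoc a (c β) (v β w)))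
      (trans (∑-*ˡ a L (λ β → c β * v β w)) (cong (a *_) (c↦f w)))

  spanned-∑ : {xs : List A} {f : A → A → ℚ} → All (λ β → Spanned (f β)) xs →
              Spanned (λ w → ∑[ β ∈ xs ] f β w)
  spanned-∑ []         = spanned-0
  spanned-∑ (s ∷ ss)   = spanned-+ s (spanned-∑ ss)

  spanned-v : ∀ {α} → P α → Spanned (v α)
  spanned-v {α} pα = (λ β → δ β α) , λ w → begin
    ∑[ β ∈ L ] (δ β α * v β w)  ≡⟨ ∑-cong L (λ β → ℚP.*-comm (δ β α) (v β w)) ⟩
    ∑[ β ∈ L ] (v β w * δ β α)  ≡⟨ ∑-δ L (λ β → v β w) α ⟩
    v α w * multiplicity α L    ≡⟨ cong (v α w *_) (multiplicity-L pα) ⟩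
    v α w * 1ℚ                  ≡⟨ ℚP.*-identityʳ (v α w) ⟩
    v α w                       ∎
    where open ≡-Reasoning

  sifting : (f : A → ℚ) → (∀ {w} → ¬ P w → f w ≡ 0ℚ) → ∀ w → ∑[ β ∈ L ] (f β * δ β w) ≡ f w
  sifting f f-supported w with P? w
  ... | yes pw = trans (∑-δ L f w) (trans (cong (f w *_) (multiplicity-L pw)) (ℚP.*-identityʳ (f w)))
  ... | no ¬pw = trans (∑-δ L f w)
    (trans (cong (_* multiplicity w L) fw≡0) (trans (ℚP.*-zeroˡ (multiplicity w L)) (sym fw≡0)))
    where fw≡0 = f-supported ¬pw

  offDiagonal : A → A → ℚ
  offDiagonal α w = v α w - δ α w

  offDiagonal-supported : ∀ {α w} → P α → ¬ P w → offDiagonal α w ≡ 0ℚ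
  offDiagonal-supported {α} {w} pα ¬pw =
    cong₂ _-_ (v-supported pα ¬pw) (δ-≢ λ { refl → ¬pw pα })

  -- δ_α = v_α − Σ_β offDiagonal α β · δ_β, where only β > α contribute.
  spanned-δ : ∀ {α} → P α → Spanned (δ α)
  spanned-δ {α} = measureRec above step α
    where
    step : ∀ α → (∀ {β} → above β ℕ.< above α → P β → Spanned (δ β)) → P α → Spanned (δ α)
    step α rec pα = spanned-ext (spanned-+ (spanned-v pα) (spanned-* (- 1ℚ) (spanned-∑ (All.map term L⊆P)))) δ-eq
      where
      zero-term : ∀ {β} → offDiagonal α β ≡ 0ℚ → Spanned (λ w → offDiagonal α β * δ β w)
      zero-term {β} od≡0 = spanned-ext spanned-0 λ w →
        trans (sym (ℚP.*-zeroˡ (δ β w))) (cong (_* δ β w) (sym od≡0))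
      term : ∀ {β} → P β → Spanned (λ w → offDiagonal α β * δ β w)
      term {β} pβ with compare α β
      ... | tri< α<β _ _     = spanned-* (offDiagonal α β) (rec (above-mono pβ α<β) pβ)
      ... | tri≈ _ refl _    = zero-term (cong₂ _-_ (v-diagonal pα) (δ-refl α))
      ... | tri> _ α≢β β<α = zero-term (cong₂ _-_ (v-vanishes-below pα β<α) (δ-≢ α≢β))
      δ-eq : ∀ w → v α w + - 1ℚ * ∑[ β ∈ L ] (offDiagonal α β * δ β w) ≡ δ α w
      δ-eq w = begin
        v α w + - 1ℚ * ∑[ β ∈ L ] (offDiagonal α β * δ β w)
          ≡⟨ cong (λ s → v α w + - 1ℚ * s) (sifting (offDiagonal α) (offDiagonal-supported pα) w) ⟩
        v α w + - 1ℚ * (v α w - δ α w)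
          ≡⟨ solve 2 (λ x d → x :+ (:- con 1ℚ) :* (x :- d) := d) refl (v α w) (δ α w) ⟩
        δ α w ∎
        where open ≡-Reasoning

  spans : (f : A → ℚ) → (∀ {w} → ¬ P w → f w ≡ 0ℚ) → Spanned f
  spans f f-supported =
    spanned-ext (spanned-∑ (All.map (λ {β} pβ → spanned-* (f β) (spanned-δ pβ)) L⊆P)) (sifting f f-supported)

-- The test used by wordEq, so that δ below unfolds to the test in coeff.
_≟w_ : DecidableEquality Word
_≟w_ = ≡-dec ℕ._≟_

open KroneckerDelta _≟w_
module ℕδ = KroneckerDelta ℕ._≟_

coeff-∑ : (v : Lin) (w : Word) → coeff v w ≡ ∑[ p ∈ v ] (δ (proj₂ p) w * proj₁ p)
coeff-∑ []             w = refl
coeff-∑ ((a , u) ∷ v) w with u ≟w w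
... | yes refl = cong₂ _+_ (sym (ℚP.*-identityˡ a)) (coeff-∑ v w)
... | no _     = trans (coeff-∑ v w) (sym (trans (cong (_+ _) (ℚP.*-zeroˡ a)) (ℚP.+-identityˡ _)))

coeff-++ : (u v : Lin) (w : Word) → coeff (u ++ v) w ≡ coeff u w + coeff v w
coeff-++ u v w = begin
  coeff (u ++ v) w                  ≡⟨ coeff-∑ (u ++ v) w ⟩
  ∑ (u ++ v) term                   ≡⟨ ∑-++ u v term ⟩
  ∑ u term + ∑ v term               ≡⟨ cong₂ _+_ (coeff-∑ u w) (coeff-∑ v w) ⟨
  coeff u w + coeff v w             ∎
  where
  open ≡-Reasoning
  term : ℚ × Word → ℚ
  term p = δ (proj₂ p) w * proj₁ p

coeff-concatMap : (g : A → Lin) (xs : List A) (w : Word) →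
                  coeff (concatMap g xs) w ≡ ∑[ x ∈ xs ] coeff (g x) w
coeff-concatMap g []       w = refl
coeff-concatMap g (x ∷ xs) w =
  trans (coeff-++ (g x) (concatMap g xs) w) (cong (coeff (g x) w +_) (coeff-concatMap g xs w))

coeff-scaleL : (c : ℚ) (v : Lin) (w : Word) → coeff (scaleL c v) w ≡ c * coeff v w
coeff-scaleL c []            w = sym (ℚP.*-zeroʳ c)
coeff-scaleL c ((a , u) ∷ v) w with u ≟w w
... | yes refl = trans (cong (c * a +_) (coeff-scaleL c v w)) (sym (ℚP.*-distribˡ-+ c a _))
... | no _     = coeff-scaleL c v w

coeff-combo : (c : Word → ℚ) (f : Word → NSym) (xs : List Word) (w : Word) →
              coeff (combo c f xs) w ≡ ∑[ β ∈ xs ] (c β * coeff (f β) w)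
coeff-combo c f xs w =
  trans (coeff-concatMap (λ β → scaleL (c β) (f β)) xs w) (∑-cong xs λ β → coeff-scaleL (c β) (f β) w)

coeff-mulWith : (f : Word → Word → Lin) (u v : Lin) (w : Word) →
                coeff (mulWith f u v) w ≡ ∑[ p ∈ u ] ∑[ r ∈ v ] (proj₁ p * proj₁ r * coeff (f (proj₂ p) (proj₂ r)) w)
coeff-mulWith f u v w = trans (coeff-concatMap _ u w) (∑-cong u λ p →
  trans (coeff-concatMap _ v w) (∑-cong v λ r → coeff-scaleL (proj₁ p * proj₁ r) (f (proj₂ p) (proj₂ r)) w))

coeff-singleton : (a : ℚ) (u w : Word) → coeff ((a , u) ∷ []) w ≡ δ u w * a
coeff-singleton a u w = trans (coeff-∑ ((a , u) ∷ []) w) (ℚP.+-identityʳ _)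

δ-∷ : (k x : ℕ) (u w : Word) → δ (k ∷ u) (x ∷ w) ≡ ℕδ.δ k x * δ u w
δ-∷ k x u w = by-cases (k ℕ.≟ x)
  where
  by-cases : Dec (k ≡ x) → δ (k ∷ u) (x ∷ w) ≡ ℕδ.δ k x * δ u w
  by-cases (yes refl) = trans (δ-injective ∷-injectiveʳ u w)
    (sym (trans (cong (_* δ u w) (ℕδ.δ-refl k)) (ℚP.*-identityˡ (δ u w))))
  by-cases (no k≢x)   = trans (δ-≢ (k≢x ∘ ∷-injectiveˡ))
    (sym (trans (cong (_* δ u w) (ℕδ.δ-≢ k≢x)) (ℚP.*-zeroˡ (δ u w))))

coeff-H· : (k x : ℕ) (h : NSym) (w : Word) → coeff (Hw (k ∷ []) ·N h) (x ∷ w) ≡ ℕδ.δ k x * coeff h w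
coeff-H· k x h w = begin
  coeff (Hw (k ∷ []) ·N h) (x ∷ w)
    ≡⟨ trans (coeff-mulWith (λ a b → (1ℚ , a ++ b) ∷ []) (Hw (k ∷ [])) h (x ∷ w)) (ℚP.+-identityʳ _) ⟩
  ∑[ r ∈ h ] (1ℚ * proj₁ r * coeff ((1ℚ , k ∷ proj₂ r) ∷ []) (x ∷ w))
    ≡⟨ ∑-cong h (λ r → term (proj₁ r) (proj₂ r)) ⟩
  ∑[ r ∈ h ] (ℕδ.δ k x * (δ (proj₂ r) w * proj₁ r))
    ≡⟨ ∑-*ˡ (ℕδ.δ k x) h _ ⟩
  ℕδ.δ k x * ∑[ r ∈ h ] (δ (proj₂ r) w * proj₁ r)
    ≡⟨ cong (ℕδ.δ k x *_) (coeff-∑ h w) ⟨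
  ℕδ.δ k x * coeff h w ∎
  where
  open ≡-Reasoning
  term : ∀ a u → 1ℚ * a * coeff ((1ℚ , k ∷ u) ∷ []) (x ∷ w) ≡ ℕδ.δ k x * (δ u w * a)
  term a u = begin
    1ℚ * a * coeff ((1ℚ , k ∷ u) ∷ []) (x ∷ w)  ≡⟨ cong (1ℚ * a *_) (coeff-singleton 1ℚ (k ∷ u) (x ∷ w)) ⟩
    1ℚ * a * (δ (k ∷ u) (x ∷ w) * 1ℚ)           ≡⟨ cong (λ d → 1ℚ * a * (d * 1ℚ)) (δ-∷ k x u w) ⟩
    1ℚ * a * (ℕδ.δ k x * δ u w * 1ℚ)            ≡⟨ solve 3 (λ a d e → con 1ℚ :* a :* (d :* e :* con 1ℚ) := d :* (e :* a))
                                                       refl a (ℕδ.δ k x) (δ u w) ⟩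
    ℕδ.δ k x * (δ u w * a)                      ∎

coeff-H·-[] : (k : ℕ) (h : NSym) → coeff (Hw (k ∷ []) ·N h) [] ≡ 0ℚ
coeff-H·-[] k h =
  trans (coeff-mulWith (λ a b → (1ℚ , a ++ b) ∷ []) (Hw (k ∷ [])) h [])
    (trans (ℚP.+-identityʳ _) (∑-zero h λ r → vanish (proj₁ r) (proj₂ r)))
  where
  vanish : ∀ a u → 1ℚ * a * coeff ((1ℚ , k ∷ u) ∷ []) [] ≡ 0ℚ
  vanish a u = trans (cong (λ d → 1ℚ * a * (d * 1ℚ)) (δ-≢ {k ∷ u} {[]} λ ())) (ℚP.*-zeroʳ (1ℚ * a))

pair-∑ : (h : NSym) (g : QSym) → pair h g ≡ ∑[ q ∈ g ] (proj₁ q * coeff h (proj₂ q))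
pair-∑ h g = begin
  pair h g
    ≡⟨ sumℚ-map h (λ p → proj₁ p * coeff g (proj₂ p)) ⟩
  ∑[ p ∈ h ] (proj₁ p * coeff g (proj₂ p))
    ≡⟨ ∑-cong h (λ p → trans (cong (proj₁ p *_) (coeff-∑ g (proj₂ p))) (sym (∑-*ˡ (proj₁ p) g _))) ⟩
  ∑[ p ∈ h ] ∑[ q ∈ g ] (proj₁ p * (δ (proj₂ q) (proj₂ p) * proj₁ q))
    ≡⟨ ∑-swap h g (λ p q → proj₁ p * (δ (proj₂ q) (proj₂ p) * proj₁ q)) ⟩
  ∑[ q ∈ g ] ∑[ p ∈ h ] (proj₁ p * (δ (proj₂ q) (proj₂ p) * proj₁ q))
    ≡⟨ ∑-cong g (λ q → ∑-cong h (λ p → reorder (proj₁ p) (proj₁ q) (proj₂ p) (proj₂ q))) ⟩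
  ∑[ q ∈ g ] ∑[ p ∈ h ] (proj₁ q * (δ (proj₂ p) (proj₂ q) * proj₁ p))
    ≡⟨ ∑-cong g (λ q → trans (∑-*ˡ (proj₁ q) h _) (cong (proj₁ q *_) (sym (coeff-∑ h (proj₂ q))))) ⟩
  ∑[ q ∈ g ] (proj₁ q * coeff h (proj₂ q)) ∎
  where
  open ≡-Reasoning
  sumℚ-map : {A : Set} (xs : List A) (f : A → ℚ) → sumℚ (map f xs) ≡ ∑ xs f
  sumℚ-map []       f = refl
  sumℚ-map (x ∷ xs) f = cong (f x +_) (sumℚ-map xs f)
  reorder : ∀ a b u w → a * (δ w u * b) ≡ b * (δ u w * a)
  reorder a b u w = trans (cong (λ d → a * (d * b)) (δ-sym w u))
    (solve 3 (λ a b d → a :* (d :* b) := b :* (d :* a)) refl a b (δ u w))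

-- Compositions

isComposition? : ∀ n w → Dec (IsComposition n w)
isComposition? n w = All.all? (1 ℕ.≤?_) w ×-dec (sum w ℕ.≟ n)

compositions-sound : ∀ n → All (IsComposition n) (compositions n)
compositions-sound zero          = ([] , refl) ∷ []
compositions-sound (suc zero)    = ((ℕ.s≤s ℕ.z≤n ∷ []) , refl) ∷ []
compositions-sound (suc (suc n)) = concat⁺ (map⁺ (All.map extend (compositions-sound (suc n))))
  where
  extend : ∀ {c} → IsComposition (suc n) c → All (IsComposition (suc (suc n))) ((1 ∷ c) ∷ incHead c ∷ [])
  extend {x ∷ c} (px ∷ ps , Σc≡1+n) =
    (ℕ.s≤s ℕ.z≤n ∷ px ∷ ps , cong suc Σc≡1+n) ∷ (ℕ.s≤s ℕ.z≤n ∷ ps , cong suc Σc≡1+n) ∷ []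

incHead-injective : Injective _≡_ _≡_ incHead
incHead-injective {[]}    {[]}    refl = refl
incHead-injective {x ∷ u} {.x ∷ .u} refl = refl

composition-of-0 : ∀ {w} → IsComposition 0 w → [] ≡ w
composition-of-0 {[]}        _            = refl
composition-of-0 {zero ∷ w}  (() ∷ _ , _)
composition-of-0 {suc x ∷ w} (_ , ())

composition-of-1 : ∀ {w} → IsComposition 1 w → 1 ∷ [] ≡ w
composition-of-1 {[]}              (_ , ())
composition-of-1 {zero ∷ w}        (() ∷ _ , _)
composition-of-1 {suc zero ∷ w}    (_ ∷ ps , Σw≡0) = cong (1 ∷_) (composition-of-0 (ps , ℕP.suc-injective Σw≡0))
composition-of-1 {suc (suc x) ∷ w} (_ , ())

multiplicity-compositions-split : ∀ n w → multiplicity w (compositions (suc (suc n))) ≡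
  multiplicity w (map (1 ∷_) (compositions (suc n))) + multiplicity w (map incHead (compositions (suc n)))
multiplicity-compositions-split n w = begin
  multiplicity w (compositions (suc (suc n)))
    ≡⟨ ∑-concatMap (λ c → (1 ∷ c) ∷ incHead c ∷ []) C (λ u → δ u w) ⟩
  ∑[ c ∈ C ] (δ (1 ∷ c) w + (δ (incHead c) w + 0ℚ))
    ≡⟨ ∑-cong C (λ c → cong (δ (1 ∷ c) w +_) (ℚP.+-identityʳ _)) ⟩
  ∑[ c ∈ C ] (δ (1 ∷ c) w + δ (incHead c) w)
    ≡⟨ ∑-+ C (λ c → δ (1 ∷ c) w) (λ c → δ (incHead c) w) ⟩
  ∑[ c ∈ C ] δ (1 ∷ c) w + ∑[ c ∈ C ] δ (incHead c) w
    ≡⟨ cong₂ _+_ (∑-map (1 ∷_) C (λ u → δ u w)) (∑-map incHead C (λ u → δ u w)) ⟨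
  multiplicity w (map (1 ∷_) C) + multiplicity w (map incHead C) ∎
  where
  open ≡-Reasoning
  C = compositions (suc n)

compositions-enumerates-step : ∀ n → Enumerates (IsComposition (suc n)) (compositions (suc n)) →
                               Enumerates (IsComposition (suc (suc n))) (compositions (suc (suc n)))
compositions-enumerates-step n IH = step
  where
  C = compositions (suc n)
  Goal : Word → Set
  Goal w = (IsComposition (suc (suc n)) w → multiplicity w (compositions (suc (suc n))) ≡ 1ℚ) ×
           (¬ IsComposition (suc (suc n)) w → multiplicity w (compositions (suc (suc n))) ≡ 0ℚ)
  via : ∀ {w} v → multiplicity w (compositions (suc (suc n))) ≡ multiplicity v C →
        (IsComposition (suc (suc n)) w → IsComposition (suc n) v) →
        (IsComposition (suc n) v → IsComposition (suc (suc n)) w) → Goal w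
  via v m≡ to from = (λ pw → trans m≡ (proj₁ (IH v) (to pw))) , (λ ¬pw → trans m≡ (proj₂ (IH v) (¬pw ∘ from)))
  absent : ∀ {w} → multiplicity w (compositions (suc (suc n))) ≡ 0ℚ → ¬ IsComposition (suc (suc n)) w → Goal w
  absent m≡0 ¬pw = (λ pw → ⊥-elim (¬pw pw)) , (λ _ → m≡0)
  one∷-∉ : ∀ {w} → (∀ u → ¬ 1 ∷ u ≡ w) → multiplicity w (map (1 ∷_) C) ≡ 0ℚ
  one∷-∉ 1∷≢w = multiplicity-map-∉ 1∷≢w C
  step : ∀ w → Goal w
  step [] = absent
    (trans (multiplicity-compositions-split n [])
      (cong₂ _+_ (one∷-∉ λ _ ()) (trans (multiplicity-map-injective incHead-injective [] C)
                                   (proj₂ (IH []) λ { (_ , ()) }))))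
    λ { (_ , ()) }
  step (zero ∷ w) = absent
    (trans (multiplicity-compositions-split n (0 ∷ w))
      (cong₂ _+_ (one∷-∉ λ _ ()) (multiplicity-map-∉ (λ { [] () ; (_ ∷ _) () }) C)))
    λ { (() ∷ _ , _) }
  step (suc zero ∷ w) = via w
    (trans (multiplicity-compositions-split n (1 ∷ w))
      (trans (cong₂ _+_ (multiplicity-map-injective ∷-injectiveʳ w C)
                        (trans (multiplicity-map-injective incHead-injective (0 ∷ w) C)
                               (proj₂ (IH (0 ∷ w)) λ { (() ∷ _ , _) })))
             (ℚP.+-identityʳ _)))
    (λ { (_ ∷ ps , Σ≡) → ps , ℕP.suc-injective Σ≡ })
    (λ { (ps , Σ≡) → ℕ.s≤s ℕ.z≤n ∷ ps , cong suc Σ≡ })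
  step (suc (suc x) ∷ w) = via (suc x ∷ w)
    (trans (multiplicity-compositions-split n (suc (suc x) ∷ w))
      (trans (cong₂ _+_ (one∷-∉ λ _ ()) (multiplicity-map-injective incHead-injective (suc x ∷ w) C))
             (ℚP.+-identityˡ _)))
    (λ { (_ ∷ ps , Σ≡) → ℕ.s≤s ℕ.z≤n ∷ ps , ℕP.suc-injective Σ≡ })
    (λ { (_ ∷ ps , Σ≡) → ℕ.s≤s ℕ.z≤n ∷ ps , cong suc Σ≡ })

compositions-enumerates : ∀ n → Enumerates (IsComposition n) (compositions n)
compositions-enumerates zero          = enumerates-singleton composition-of-0 ([] , refl)
compositions-enumerates (suc zero)    = enumerates-singleton composition-of-1 ((ℕ.s≤s ℕ.z≤n ∷ []) , refl)
compositions-enumerates (suc (suc n)) = compositions-enumerates-step n (compositions-enumerates (suc n))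

multiplicity-compositions-≡1 : ∀ n {w} → IsComposition n w → multiplicity w (compositions n) ≡ 1ℚ
multiplicity-compositions-≡1 n {w} = proj₁ (compositions-enumerates n w)

multiplicity-compositionsUpTo : ∀ D w →
  multiplicity w (compositionsUpTo D) ≡ ∑[ k ∈ upTo (suc D) ] multiplicity w (compositions k)
multiplicity-compositionsUpTo D w = ∑-concatMap compositions (upTo (suc D)) (λ u → δ u w)

multiplicity-compositionsUpTo-≤ : ∀ {s D w} → IsComposition s w → s ℕ.≤ D →
                                  multiplicity w (compositionsUpTo D) ≡ 1ℚ
multiplicity-compositionsUpTo-≤ {s} {D} {w} pw s≤D = begin
  multiplicity w (compositionsUpTo D)                   ≡⟨ multiplicity-compositionsUpTo D w ⟩
  ∑[ k ∈ upTo (suc D) ] multiplicity w (compositions k) ≡⟨ ∑-cong (upTo (suc D)) (λ k → by-cases k (k ℕ.≟ s)) ⟩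
  ℕδ.multiplicity s (upTo (suc D))                      ≡⟨ ℕδ.multiplicity-unique (upTo⁺ (suc D)) (∈-upTo⁺ (ℕ.s≤s s≤D)) ⟩
  1ℚ                                                    ∎
  where
  open ≡-Reasoning
  by-cases : ∀ k → Dec (k ≡ s) → multiplicity w (compositions k) ≡ ℕδ.δ k s
  by-cases k (yes refl) = trans (proj₁ (compositions-enumerates k w) pw) (sym (ℕδ.δ-refl k))
  by-cases k (no k≢s)   = trans (proj₂ (compositions-enumerates k w) λ pw′ → k≢s (trans (sym (proj₂ pw′)) (proj₂ pw)))
                                (sym (ℕδ.δ-≢ k≢s))

multiplicity-compositionsUpTo-nonpositive : ∀ {D w} → ¬ All (1 ℕ.≤_) w →
                                            multiplicity w (compositionsUpTo D) ≡ 0ℚ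
multiplicity-compositionsUpTo-nonpositive {D} {w} ¬pos =
  trans (multiplicity-compositionsUpTo D w)
        (∑-zero (upTo (suc D)) λ k → proj₂ (compositions-enumerates k w) (¬pos ∘ proj₁))

-- Degrees, the pairing and F^⊥

degBound-bounds : ∀ h {w} → ¬ coeff h w ≡ 0ℚ → sum w ℕ.≤ degBound h
degBound-bounds []            h≢0 = ⊥-elim (h≢0 refl)
degBound-bounds ((a , u) ∷ h) {w} h≢0 with u ≟w w
... | yes refl = ℕP.m≤m⊔n (sum u) (degBound h)
... | no _     = ℕP.≤-trans (degBound-bounds h h≢0) (ℕP.m≤n⊔m (sum u) (degBound h))

Homogeneous : ℕ → Lin → Set
Homogeneous d g = All (λ q → sum (proj₂ q) ≡ d) g

qsh-homogeneous : ∀ a b → All (λ c → sum c ≡ sum a ℕ.+ sum b) (qsh a b)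
qsh-homogeneous []      b       = refl ∷ []
qsh-homogeneous (x ∷ a) []      = sym (ℕP.+-identityʳ _) ∷ []
qsh-homogeneous (x ∷ a) (y ∷ b) =
  ++⁺ (map⁺ (All.map (λ e → trans (cong (x ℕ.+_) e) (take-x x y (sum a) (sum b))) (qsh-homogeneous a (y ∷ b))))
  (++⁺ (map⁺ (All.map (λ e → trans (cong (y ℕ.+_) e) (take-y x y (sum a) (sum b))) (qsh-homogeneous (x ∷ a) b)))
       (map⁺ (All.map (λ e → trans (cong (x ℕ.+ y ℕ.+_) e) (take-xy x y (sum a) (sum b))) (qsh-homogeneous a b))))
  where
  take-x : ∀ x y s t → x ℕ.+ (s ℕ.+ (y ℕ.+ t)) ≡ (x ℕ.+ s) ℕ.+ (y ℕ.+ t)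
  take-x = solve-∀
  take-y : ∀ x y s t → y ℕ.+ ((x ℕ.+ s) ℕ.+ t) ≡ (x ℕ.+ s) ℕ.+ (y ℕ.+ t)
  take-y = solve-∀
  take-xy : ∀ x y s t → x ℕ.+ y ℕ.+ (s ℕ.+ t) ≡ (x ℕ.+ s) ℕ.+ (y ℕ.+ t)
  take-xy = solve-∀

·Q-homogeneous : ∀ {d e f g} → Homogeneous d f → Homogeneous e g → Homogeneous (d ℕ.+ e) (f ·Q g)
·Q-homogeneous {d} {e} {f} {g} f-deg g-deg = concat⁺ (map⁺ (All.map (λ {p} Σp≡d →
  concat⁺ (map⁺ (All.map (λ {r} Σr≡e →
    map⁺ (map⁺ (All.map (λ Σ≡ → trans Σ≡ (cong₂ ℕ._+_ Σp≡d Σr≡e)) (qsh-homogeneous (proj₂ p) (proj₂ r)))))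
    g-deg))) f-deg))

Fq-homogeneous : ∀ α → Homogeneous (sum α) (Fq α)
Fq-homogeneous α = map⁺ (filter⁺ (T? ∘ λ β → refinesᵇ β α) (All.map proj₂ (compositions-sound (sum α))))

pair-homogeneous : ∀ {n d h g} → InNSym n h → Homogeneous d g → ¬ d ≡ n → pair h g ≡ 0ℚ
pair-homogeneous {n} {d} {h} {g} h∈NSymₙ g-deg d≢n =
  trans (pair-∑ h g) (trans (∑-cong-All {g = λ _ → 0ℚ} (λ {q} → vanish {q}) g-deg) (∑-zero g λ _ → refl))
  where
  vanish : ∀ {q} → sum (proj₂ q) ≡ d → proj₁ q * coeff h (proj₂ q) ≡ 0ℚ
  vanish {q} Σq≡d = trans (cong (proj₁ q *_) (h∈NSymₙ (proj₂ q) λ pq → d≢n (trans (sym Σq≡d) (proj₂ pq))))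
                          (ℚP.*-zeroʳ (proj₁ q))

coeff-perp : ∀ f h w →
  coeff (perp f h) w ≡ pair h (f ·Q M w) * multiplicity w (compositionsUpTo (degBound h))
coeff-perp f h w = begin
  coeff (perp f h) w                        ≡⟨ coeff-∑ (perp f h) w ⟩
  ∑ (perp f h) (λ p → δ (proj₂ p) w * proj₁ p)
    ≡⟨ ∑-map (λ β → pair h (f ·Q M β) , β) L (λ p → δ (proj₂ p) w * proj₁ p) ⟩
  ∑[ β ∈ L ] (δ β w * pair h (f ·Q M β))   ≡⟨ ∑-cong L (λ β → ℚP.*-comm (δ β w) _) ⟩
  ∑[ β ∈ L ] (pair h (f ·Q M β) * δ β w)   ≡⟨ ∑-δ L (λ β → pair h (f ·Q M β)) w ⟩
  pair h (f ·Q M w) * multiplicity w L      ∎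
  where
  open ≡-Reasoning
  L = compositionsUpTo (degBound h)

coeff-perp-one : ∀ {n} h → InNSym n h → ∀ w → coeff (perp (Fq []) h) w ≡ coeff h w
coeff-perp-one {n} h h∈NSymₙ w = begin
  coeff (perp (Fq []) h) w                                       ≡⟨ coeff-perp (Fq []) h w ⟩
  pair h ((1ℚ , w) ∷ []) * multiplicity w (compositionsUpTo (degBound h))
    ≡⟨ cong (_* m) (trans (pair-∑ h ((1ℚ , w) ∷ [])) (trans (ℚP.+-identityʳ _) (ℚP.*-identityˡ (coeff h w)))) ⟩
  coeff h w * m                                                  ≡⟨ by-cases (coeff h w ℚ.≟ 0ℚ) ⟩
  coeff h w                                                      ∎
  where
  open ≡-Reasoning
  m = multiplicity w (compositionsUpTo (degBound h))
  by-cases : Dec (coeff h w ≡ 0ℚ) → coeff h w * m ≡ coeff h w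
  by-cases (yes h≡0) = trans (cong (_* m) h≡0) (trans (ℚP.*-zeroˡ m) (sym h≡0))
  by-cases (no h≢0) with isComposition? n w
  ... | yes pw  = trans (cong (coeff h w *_) (multiplicity-compositionsUpTo-≤ pw
                          (subst (ℕ._≤ degBound h) (proj₂ pw) (degBound-bounds h h≢0))))
                        (ℚP.*-identityʳ (coeff h w))
  ... | no ¬pw = ⊥-elim (h≢0 (h∈NSymₙ w ¬pw))

coeff-perp-off-degree : ∀ {n d} F h w → InNSym n h → Homogeneous d F →
                        (All (1 ℕ.≤_) w → ¬ d ℕ.+ sum w ≡ n) → coeff (perp F h) w ≡ 0ℚ
coeff-perp-off-degree {n} {d} F h w h∈NSymₙ F-deg off = trans (coeff-perp F h w) (by-cases (All.all? (1 ℕ.≤?_) w))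
  where
  m = multiplicity w (compositionsUpTo (degBound h))
  by-cases : Dec (All (1 ℕ.≤_) w) → pair h (F ·Q M w) * m ≡ 0ℚ
  by-cases (yes pos) = trans (cong (_* m) (pair-homogeneous {h = h} {g = F ·Q M w} h∈NSymₙ
                                             (·Q-homogeneous F-deg (refl ∷ [])) (off pos)))
                             (ℚP.*-zeroˡ m)
  by-cases (no ¬pos) = trans (cong (pair h (F ·Q M w) *_) (multiplicity-compositionsUpTo-nonpositive {degBound h} ¬pos))
                             (ℚP.*-zeroʳ (pair h (F ·Q M w)))

-- The operators 𝔹_m and 𝔖_α

coeff-𝔹 : ∀ m h w → coeff (𝔹 (ℤ.+ suc m) h) w ≡
  ∑[ i ∈ upTo (suc (degBound h)) ] (signℚ i * coeff (Hw (suc m ℕ.+ i ∷ []) ·N perp (Fq (replicate i 1)) h) w)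
coeff-𝔹 m h w =
  trans (coeff-concatMap (λ i → scaleL (signℚ i) (term i)) (upTo (suc (degBound h))) w)
        (∑-cong (upTo (suc (degBound h))) λ i → coeff-scaleL (signℚ i) (term i) w)
  where
  term : ℕ → NSym
  term i = Hw (suc m ℕ.+ i ∷ []) ·N perp (Fq (replicate i 1)) h

coeff-𝔹-∷ : ∀ m h x w → coeff (𝔹 (ℤ.+ suc m) h) (x ∷ w) ≡
  ∑[ i ∈ upTo (suc (degBound h)) ] (signℚ i * (ℕδ.δ (suc m ℕ.+ i) x * coeff (perp (Fq (replicate i 1)) h) w))
coeff-𝔹-∷ m h x w = trans (coeff-𝔹 m h (x ∷ w)) (∑-cong (upTo (suc (degBound h))) λ i →
  cong (signℚ i *_) (coeff-H· (suc m ℕ.+ i) x (perp (Fq (replicate i 1)) h) w))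

coeff-𝔹-[] : ∀ m h → coeff (𝔹 (ℤ.+ suc m) h) [] ≡ 0ℚ
coeff-𝔹-[] m h = trans (coeff-𝔹 m h []) (∑-zero (upTo (suc (degBound h))) λ i →
  trans (cong (signℚ i *_) (coeff-H·-[] (suc m ℕ.+ i) (perp (Fq (replicate i 1)) h))) (ℚP.*-zeroʳ (signℚ i)))

coeff-𝔹-below : ∀ m h {x} w → x ℕ.< suc m → coeff (𝔹 (ℤ.+ suc m) h) (x ∷ w) ≡ 0ℚ
coeff-𝔹-below m h {x} w x<1+m = trans (coeff-𝔹-∷ m h x w) (∑-zero (upTo (suc (degBound h))) vanish)
  where
  vanish : ∀ i → signℚ i * (ℕδ.δ (suc m ℕ.+ i) x * coeff (perp (Fq (replicate i 1)) h) w) ≡ 0ℚ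
  vanish i = begin
    signℚ i * (ℕδ.δ (suc m ℕ.+ i) x * T)  ≡⟨ cong (λ d → signℚ i * (d * T)) (ℕδ.δ-≢ 1+m+i≢x) ⟩
    signℚ i * (0ℚ * T)                   ≡⟨ cong (signℚ i *_) (ℚP.*-zeroˡ T) ⟩
    signℚ i * 0ℚ                         ≡⟨ ℚP.*-zeroʳ (signℚ i) ⟩
    0ℚ                                   ∎
    where
    open ≡-Reasoning
    T = coeff (perp (Fq (replicate i 1)) h) w
    1+m+i≢x : ¬ suc m ℕ.+ i ≡ x
    1+m+i≢x = ℕP.>⇒≢ (ℕP.<-≤-trans x<1+m (ℕP.m≤m+n (suc m) i))

coeff-𝔹-head : ∀ m {n} h → InNSym n h → ∀ w → coeff (𝔹 (ℤ.+ suc m) h) (suc m ∷ w) ≡ coeff h w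
coeff-𝔹-head m h h∈NSymₙ w = begin
  coeff (𝔹 (ℤ.+ suc m) h) (suc m ∷ w)
    ≡⟨ coeff-𝔹-∷ m h (suc m) w ⟩
  ∑[ i ∈ I ] (signℚ i * (ℕδ.δ (suc m ℕ.+ i) (suc m) * T i))
    ≡⟨ ∑-cong I (λ i → reorder i) ⟩
  ∑[ i ∈ I ] (signℚ i * T i * ℕδ.δ i 0)
    ≡⟨ ℕδ.∑-δ I (λ i → signℚ i * T i) 0 ⟩
  signℚ 0 * T 0 * ℕδ.multiplicity 0 I
    ≡⟨ cong (signℚ 0 * T 0 *_) (ℕδ.multiplicity-unique (upTo⁺ (suc (degBound h))) (∈-upTo⁺ (ℕ.s≤s ℕ.z≤n))) ⟩
  1ℚ * T 0 * 1ℚ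
    ≡⟨ trans (ℚP.*-identityʳ _) (ℚP.*-identityˡ (T 0)) ⟩
  T 0
    ≡⟨ coeff-perp-one h h∈NSymₙ w ⟩
  coeff h w ∎
  where
  open ≡-Reasoning
  I = upTo (suc (degBound h))
  T : ℕ → ℚ
  T i = coeff (perp (Fq (replicate i 1)) h) w
  reorder : ∀ i → signℚ i * (ℕδ.δ (suc m ℕ.+ i) (suc m) * T i) ≡ signℚ i * T i * ℕδ.δ i 0
  reorder i = begin
    signℚ i * (ℕδ.δ (suc m ℕ.+ i) (suc m) * T i)
      ≡⟨ cong (λ k → signℚ i * (ℕδ.δ (suc m ℕ.+ i) k * T i)) (ℕP.+-identityʳ (suc m)) ⟨
    signℚ i * (ℕδ.δ (suc m ℕ.+ i) (suc m ℕ.+ 0) * T i)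
      ≡⟨ cong (λ d → signℚ i * (d * T i)) (ℕδ.δ-injective (ℕP.+-cancelˡ-≡ (suc m) _ _) i 0) ⟩
    signℚ i * (ℕδ.δ i 0 * T i)
      ≡⟨ solve 3 (λ s d t → s :* (d :* t) := s :* t :* d) refl (signℚ i) (ℕδ.δ i 0) (T i) ⟩
    signℚ i * T i * ℕδ.δ i 0 ∎

sum-replicate-1 : ∀ i → sum (replicate i 1) ≡ i
sum-replicate-1 zero    = refl
sum-replicate-1 (suc i) = cong suc (sum-replicate-1 i)

𝔹-homogeneous : ∀ m {n} h → InNSym n h → InNSym (suc m ℕ.+ n) (𝔹 (ℤ.+ suc m) h)
𝔹-homogeneous m h h∈NSymₙ []      _     = coeff-𝔹-[] m h
𝔹-homogeneous m {n} h h∈NSymₙ (x ∷ w) ¬comp =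
  trans (coeff-𝔹-∷ m h x w) (∑-zero (upTo (suc (degBound h))) λ i →
    trans (cong (signℚ i *_) (by-cases i (suc m ℕ.+ i ℕ.≟ x))) (ℚP.*-zeroʳ (signℚ i)))
  where
  T : ℕ → ℚ
  T i = coeff (perp (Fq (replicate i 1)) h) w
  by-cases : ∀ i → Dec (suc m ℕ.+ i ≡ x) → ℕδ.δ (suc m ℕ.+ i) x * T i ≡ 0ℚ
  by-cases i (no ≢x)   = trans (cong (_* T i) (ℕδ.δ-≢ ≢x)) (ℚP.*-zeroˡ (T i))
  by-cases i (yes refl) = trans (cong (_* T i) (ℕδ.δ-refl (suc m ℕ.+ i)))
    (trans (ℚP.*-identityˡ (T i)) (coeff-perp-off-degree (Fq (replicate i 1)) h w h∈NSymₙ (Fq-homogeneous (replicate i 1))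
      λ pos deg≡n → ¬comp ((ℕ.s≤s ℕ.z≤n ∷ pos) , trans (ℕP.+-assoc (suc m) i (sum w))
        (cong (suc m ℕ.+_) (trans (cong (ℕ._+ sum w) (sym (sum-replicate-1 i))) deg≡n)))))

𝔖c-homogeneous : ∀ {α} → All (1 ℕ.≤_) α → InNSym (sum α) (𝔖c α)
𝔖c-homogeneous {[]}        []         w ¬comp = trans (coeff-singleton 1ℚ [] w)
                                                      (cong (_* 1ℚ) (δ-≢ {[]} {w} λ { refl → ¬comp ([] , refl) }))
𝔖c-homogeneous {suc m ∷ α} (_ ∷ pos) = 𝔹-homogeneous m (𝔖c α) (𝔖c-homogeneous pos)

𝔖c-diagonal : ∀ {α} → All (1 ℕ.≤_) α → coeff (𝔖c α) α ≡ 1ℚ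
𝔖c-diagonal {[]}        []        = refl
𝔖c-diagonal {suc m ∷ α} (_ ∷ pos) = trans (coeff-𝔹-head m (𝔖c α) (𝔖c-homogeneous pos) α) (𝔖c-diagonal pos)

_<lex_ : Word → Word → Set
_<lex_ = Lex-< _≡_ ℕ._<_

<lex-isStrictTotalOrder : IsStrictTotalOrder _≡_ _<lex_
<lex-isStrictTotalOrder = record
  { isStrictPartialOrder = record
    { isEquivalence = isEquivalence
    ; irrefl        = λ { refl → Lex.<-irreflexive ℕP.<-irrefl (≡⇒Pointwise-≡ refl) }
    ; trans         = Lex.<-transitive isEquivalence (resp₂ ℕ._<_) ℕP.<-trans
    ; <-resp-≈      = resp₂ _<lex_
    }
  ; compare = λ u v → from-pointwise (Lex.<-compare sym ℕP.<-cmp u v)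
  }
  where
  from-pointwise : ∀ {u v} → Tri (u <lex v) (Pointwise _≡_ u v) (v <lex u) → Tri (u <lex v) (u ≡ v) (v <lex u)
  from-pointwise (tri< u<v u≉v v≮u) = tri< u<v (u≉v ∘ ≡⇒Pointwise-≡) v≮u
  from-pointwise (tri≈ u≮v u≈v v≮u) = tri≈ u≮v (Pointwise-≡⇒≡ u≈v) v≮u
  from-pointwise (tri> u≮v u≉v v<u) = tri> u≮v (u≉v ∘ ≡⇒Pointwise-≡) v<u

𝔖c-vanishes-below : ∀ {α w} → All (1 ℕ.≤_) α → w <lex α → coeff (𝔖c α) w ≡ 0ℚ
𝔖c-vanishes-below {[]}        _         (base ())
𝔖c-vanishes-below {zero ∷ α}  (() ∷ _)  _
𝔖c-vanishes-below {suc m ∷ α} {[]}    _         halt           = coeff-𝔹-[] m (𝔖c α)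
𝔖c-vanishes-below {suc m ∷ α} {x ∷ w} _         (this x<1+m)   = coeff-𝔹-below m (𝔖c α) w x<1+m
𝔖c-vanishes-below {suc m ∷ α} {x ∷ w} (_ ∷ pos) (next refl w<α) =
  trans (coeff-𝔹-head m (𝔖c α) (𝔖c-homogeneous pos) w) (𝔖c-vanishes-below pos w<α)

𝔖c-∈NSym : ∀ {n α} → IsComposition n α → InNSym n (𝔖c α)
𝔖c-∈NSym (pos , refl) = 𝔖c-homogeneous pos

module 𝔖-Basis (n : ℕ) = UnitriangularBasis _≟w_ <lex-isStrictTotalOrder (isComposition? n)
  (compositions n) (compositions-sound n) (multiplicity-compositions-≡1 n)
  (λ α → coeff (𝔖c α)) (λ pα ¬pw → 𝔖c-∈NSym pα _ ¬pw) (𝔖c-diagonal ∘ proj₁) (𝔖c-vanishes-below ∘ proj₁)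

corollary3p12 : (n : ℕ) →
    ((α : Word) → IsComposition n α → InNSym n (𝔖c α))
    × ((v : NSym) → InNSym n v →
        ∃[ c ] ((w : Word) → coeff (combo c 𝔖c (compositions n)) w ≡ coeff v w))
    × ((c : Word → ℚ) →
        ((w : Word) → coeff (combo c 𝔖c (compositions n)) w ≡ 0ℚ) →
        (α : Word) → IsComposition n α → c α ≡ 0ℚ)
corollary3p12 n = (λ _ → 𝔖c-∈NSym) , spanning , independent
  where
  open 𝔖-Basis n
  combo≡combination : ∀ c w → coeff (combo c 𝔖c (compositions n)) w ≡ combination c w
  combo≡combination c w = coeff-combo c 𝔖c (compositions n) w
  spanning : (v : NSym) → InNSym n v → ∃[ c ] ((w : Word) → coeff (combo c 𝔖c (compositions n)) w ≡ coeff v w)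
  spanning v v∈NSymₙ = c , λ w → trans (combo≡combination c w) (combination≡v w)
    where
    c = proj₁ (spans (coeff v) (λ {w} → v∈NSymₙ w))
    combination≡v = proj₂ (spans (coeff v) (λ {w} → v∈NSymₙ w))
  independent : (c : Word → ℚ) → ((w : Word) → coeff (combo c 𝔖c (compositions n)) w ≡ 0ℚ) →
                (α : Word) → IsComposition n α → c α ≡ 0ℚ
  independent c combo≡0 α = linearlyIndependent c (λ w → trans (sym (combo≡combination c w)) (combo≡0 w))
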